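{- For every integer $k\ge1$, $\mathbf{H}_k\subseteq \mathbb{Q}\cap[0,1]$; that is, every countable hypergraph whose hyperedges all have cardinality at most $k$ has rational independence density.
   Context: A countable hypergraph $H=(V,E)$ has a countable vertex set and a collection $E$ of finite subsets of $V$ (hyperedges). An independent set is a subset of $V$ containing no hyperedge. For a finite hypergraph $F$ on $n$ vertices, $\mathrm{id}(F)=i(F)/2^n$, where $i(F)$ is the number of independent sets of $F$ (including $\emptyset$). For countable $H$, $\mathrm{id}(H)=\lim_{n\to\infty}\mathrm{id}(H_n)$ for any sequence $(H_n)$ of finite induced subhypergraphs of $H$ with $H_n$ induced in $H_{n+1}$ and $\bigcup_n V(H_n)=V(H)$; this limit exists and is independent of the sequence. $\mathbf{H}_k=\{x\in[0,1]: \mathrm{id}(H)=x \text{ for some countable hypergraph } H \text{ all of whose hyperedges have cardinality at most } k\}$. -}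

module Defs where

open import Level using (0ℓ)
open import Data.Bool using (Bool; true; false)
open import Data.Nat as ℕ using (ℕ; zero; suc; _<_; _≤_; _^_)
open import Data.Nat.Properties using (m^n≢0)
open import Data.Fin using (Fin; fromℕ<)
open import Data.Vec using (Vec; lookup)
open import Data.List using (List; length)
open import Data.List.Relation.Unary.All using (All)
open import Data.List.Relation.Unary.Unique.Propositional using (Unique)
open import Data.List.Membership.Propositional using (_∈_)
open import Data.Product using (Σ; _×_; _,_; ∃)
open import Data.Integer using (+_)
open import Data.Rational using (ℚ; _/_)
open import Relation.Binary.PropositionalEquality using (_≡_)
open import Relation.Nullary using (¬_)
open import Function.Bundles using (_⇔_)

-- Hyperedges are
-- finite subsets of V: every list l with E l represents the hyperedge
-- {elements of l}; the collection of hyperedges is the collection of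
-- these sets.  (Any collection of finite subsets arises this way.)
record Hypergraph : Set₁ where
  field
    V    : ℕ → Bool
    E    : List ℕ → Set
    E⊆V  : ∀ l → E l → All (λ x → V x ≡ true) l
open Hypergraph public

-- All hyperedges have cardinality at most k (each hyperedge is
-- represented by lists of length ≤ k; any collection of sets of size
-- ≤ k can be represented this way).
RankAtMost : ℕ → Hypergraph → Set
RankAtMost k H = ∀ l → E H l → length l ≤ k

_∈ₛ_ : ∀ {n} → ℕ → Vec Bool n → Set
_∈ₛ_ {n} x S = Σ (x < n) λ x<n → lookup S (fromℕ< x<n) ≡ true

-- H_n : the induced finite subhypergraph of H on V ∩ {0,…,n-1}.
-- S is an independent set of H_n: S ⊆ V ∩ [0,n) and S contains no hyperedge
-- (hyperedges of H_n are exactly hyperedges of H contained in [0,n)).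
IndepSet : (H : Hypergraph) (n : ℕ) → Vec Bool n → Set
IndepSet H n S =
  (∀ x → x ∈ₛ S → V H x ≡ true) ×
  (∀ l → E H l → ¬ All (λ x → x ∈ₛ S) l)

IndepCount : (H : Hypergraph) (n : ℕ) → ℕ → Set
IndepCount H n c =
  Σ (List (Vec Bool n)) λ L →
    Unique L × (∀ S → (S ∈ L) ⇔ IndepSet H n S) × length L ≡ c

vcount : (H : Hypergraph) → ℕ → ℕ
vcount H zero = zero
vcount H (suc n) with V H n
... | true  = suc (vcount H n)
... | false = vcount H n

idFin : (H : Hypergraph) (n c : ℕ) → ℚ
idFin H n c = _/_ (+ c) (2 ^ vcount H n) {{m^n≢0 2 (vcount H n)}}

-- id(H) = q : the densities id(H_n) of the exhausting chain
-- H_0 ⊆ H_1 ⊆ … (H_n induced in H_{n+1}, ⋃ V(H_n) = V(H)) converge to q.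
HasIdDensity : Hypergraph → ℚ → Set
HasIdDensity H q =
  ∀ (ε : ℚ) → Data.Rational.0ℚ Data.Rational.< ε →
    ∃ λ N → ∀ n → N ≤ n → ∀ c → IndepCount H n c →
      Data.Rational.∣ idFin H n c Data.Rational.- q ∣ Data.Rational.< ε

module Submission where

-- Let nFree E n count the subsets of [0, n) containing no hyperedge, ignoring V: each vertex of
-- [0, n) outside V contributes the same factor 2 to nFree and to 2 ^ n, so id(H_n) = nFree / 2 ^ n.
-- This ratio is non-increasing in n, and its limit is rational by induction on the rank k. If the
-- hyperedges have a finite transversal T, split on a vertex v ∈ T: the sets avoiding v see the
-- hyperedges not containing v, the sets containing v see the hyperedges with v removed, so the
-- density is the mean of the densities of these two families, and once all of T is split off no
-- hyperedge of size k is left. Otherwise there are arbitrarily many pairwise disjoint hyperedges,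
-- each contained in a random set independently with probability at least 2 ^ -k, so the density
-- is 0. Excluded middle is used to count the subsets satisfying an arbitrary predicate.

open import Level using (0ℓ)
open import Axiom.ExcludedMiddle using (ExcludedMiddle)
open import Function using (_∘_; _$_)
open import Function.Bundles using (_⇔_; mk⇔; Equivalence)
open import Function.Properties.Equivalence using () renaming (sym to ⇔-sym)
open import Data.Bool using (Bool; true; false)
open import Data.Empty using (⊥-elim)
open import Data.Unit using (⊤)
open import Data.Product using (∃; _×_; _,_; proj₁; proj₂; map₁; map₂)
open import Data.Sum using (_⊎_; inj₁; inj₂)
open import Data.Nat as ℕ using (ℕ; zero; suc; _+_; _*_; _^_; _∸_; _≤_; _<_; z≤n; s≤s; NonZero; _≟_; _≤?_)
open import Data.Nat.Properties
open import Data.Nat.Tactic.RingSolver using (solve-∀)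
open import Algebra.Properties.CommutativeSemigroup +-commutativeSemigroup using () renaming (interchange to +-interchange)
open import Algebra.Properties.CommutativeSemigroup *-commutativeSemigroup using (x∙yz≈y∙xz; xy∙z≈y∙xz)
open import Data.Integer as ℤ using (+_; -[1+_])
import Data.Integer.Properties as ℤ
open import Data.Rational using (ℚ; mkℚ; 0ℚ; 1ℚ; toℚᵘ)
import Data.Rational as ℚ
import Data.Rational.Properties as ℚ
import Data.Rational.Unnormalised as ℚᵘ
import Data.Rational.Unnormalised.Properties as ℚᵘ
open import Algebra.Properties.AbelianGroup ℚ.+-0-abelianGroup using (xyx⁻¹≈y)
open import Data.Fin using (fromℕ<)
open import Data.Vec as Vec using (Vec; _∷_; _∷ʳ_; lookup; initLast)
open import Data.Vec.Properties using (∷ʳ-injectiveˡ; ∷ʳ-injectiveʳ)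
open import Data.List using (List; []; _∷_; length; map; _++_; concat; filter)
open import Data.List.Properties using (length-++; length-map; length-filter; filter-notAll; filter-all)
open import Data.List.Relation.Unary.All as All using (All; []; _∷_)
open import Data.List.Relation.Unary.All.Properties using (concat⁻)
open import Data.List.Relation.Unary.Any as Any using (Any; here; there)
open import Data.List.Relation.Unary.AllPairs using (AllPairs; []; _∷_)
open import Data.List.Relation.Unary.Unique.Propositional using (Unique)
import Data.List.Relation.Unary.Unique.Propositional.Properties as Unique
open import Data.List.Relation.Binary.Disjoint.Propositional using (Disjoint)
open import Data.List.Relation.Binary.BagAndSetEquality using (∼bag⇒↭)
open import Data.List.Relation.Binary.Permutation.Propositional.Properties using (↭-length)
open import Data.List.Membership.Propositional using (_∈_; _∉_; find; lose)
open import Data.List.Membership.Propositional.Properties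
  using (∈-map⁺; ∈-map⁻; ∈-++⁺ˡ; ∈-++⁺ʳ; ∈-++⁻; ∈-concat⁺′; ∈-filter⁺; ∈-filter⁻)
open import Data.List.Membership.Propositional.Properties.WithK using (unique∧set⇒bag)
open import Data.List.Membership.DecPropositional _≟_ using (_∈?_)
open import Relation.Nullary using (¬_; Dec; yes; no; ¬?)
open import Relation.Nullary.Decidable using (decidable-stable)
open import Relation.Binary.PropositionalEquality
  using (_≡_; _≢_; refl; sym; trans; cong; cong₂; subst; subst₂; module ≡-Reasoning)

open import Defs

-- Subsets of [0, n) as bit vectors

lookup-∷ʳ-< : ∀ {n x} (S : Vec Bool n) b (p : x < suc n) (q : x < n) →
              lookup (S ∷ʳ b) (fromℕ< p) ≡ lookup S (fromℕ< q)
lookup-∷ʳ-< {x = zero}  (s ∷ S) b p       q       = refl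
lookup-∷ʳ-< {x = suc x} (s ∷ S) b (s≤s p) (s≤s q) = lookup-∷ʳ-< S b p q

lookup-∷ʳ-last : ∀ {n} (S : Vec Bool n) b (p : n < suc n) → lookup (S ∷ʳ b) (fromℕ< p) ≡ b
lookup-∷ʳ-last Vec.[] b (s≤s z≤n) = refl
lookup-∷ʳ-last (s ∷ S) b (s≤s p)  = lookup-∷ʳ-last S b p

∈ₛ-∷ʳ⁻ : ∀ {n x} (S : Vec Bool n) b → x ∈ₛ (S ∷ʳ b) → x ∈ₛ S ⊎ (x ≡ n × b ≡ true)
∈ₛ-∷ʳ⁻ S b (p , e) with m<1+n⇒m<n∨m≡n p
... | inj₁ x<n  = inj₁ (x<n , trans (sym (lookup-∷ʳ-< S b p x<n)) e)
... | inj₂ refl = inj₂ (refl , trans (sym (lookup-∷ʳ-last S b p)) e)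

∈ₛ-∷ʳ⁺ : ∀ {n x} (S : Vec Bool n) b → x ∈ₛ S → x ∈ₛ (S ∷ʳ b)
∈ₛ-∷ʳ⁺ S b (q , e) = m<n⇒m<1+n q , trans (lookup-∷ʳ-< S b (m<n⇒m<1+n q) q) e

∈ₛ-∷ʳ-true : ∀ {n} (S : Vec Bool n) → n ∈ₛ (S ∷ʳ true)
∈ₛ-∷ʳ-true {n} S = n<1+n n , lookup-∷ʳ-last S true (n<1+n n)

∉ₛ-∷ʳ-false : ∀ {n} (S : Vec Bool n) → ¬ n ∈ₛ (S ∷ʳ false)
∉ₛ-∷ʳ-false S n∈S with ∈ₛ-∷ʳ⁻ S false n∈S
... | inj₁ (n<n , _) = <-irrefl refl n<n
... | inj₂ (_ , ())

∈ₛ-∷ʳ⁻-< : ∀ {n x} (S : Vec Bool n) b → x < n → x ∈ₛ (S ∷ʳ b) → x ∈ₛ S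
∈ₛ-∷ʳ⁻-< S b x<n x∈S with ∈ₛ-∷ʳ⁻ S b x∈S
... | inj₁ x∈S′       = x∈S′
... | inj₂ (refl , _) = ⊥-elim (<-irrefl refl x<n)

∉ₛ-[] : ∀ {x} (S : Vec Bool 0) → ¬ x ∈ₛ S
∉ₛ-[] S (() , _)

_⊆ₛ_ : ∀ {n} → List ℕ → Vec Bool n → Set
l ⊆ₛ S = All (_∈ₛ S) l

record _≈[_]_ {n} (S : Vec Bool n) (U : ℕ → Set) (S′ : Vec Bool n) : Set where
  field agree : ∀ {x} → U x → x ∈ₛ S ⇔ x ∈ₛ S′
open _≈[_]_

DependsOnlyOn : ∀ {n} → (ℕ → Set) → (Vec Bool n → Set) → Set
DependsOnlyOn U P = ∀ {S S′} → S ≈[ U ] S′ → P S → P S′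

≈-sym : ∀ {n U} {S S′ : Vec Bool n} → S ≈[ U ] S′ → S′ ≈[ U ] S
agree (≈-sym S≈S′) u = ⇔-sym (agree S≈S′ u)

≈-∷ʳ : ∀ {n U b} {S S′ : Vec Bool n} → S ≈[ U ] S′ → (S ∷ʳ b) ≈[ U ] (S′ ∷ʳ b)
agree (≈-∷ʳ S≈S′) u = mk⇔ (move S≈S′ u) (move (≈-sym S≈S′) u)
  where
  move : ∀ {n U b x} {S S′ : Vec Bool n} → S ≈[ U ] S′ → U x → x ∈ₛ (S ∷ʳ b) → x ∈ₛ (S′ ∷ʳ b)
  move {b = b} {S = S} {S′} S≈S′ u x∈S with ∈ₛ-∷ʳ⁻ S b x∈S
  ... | inj₁ x∈S′          = ∈ₛ-∷ʳ⁺ S′ b (Equivalence.to (agree S≈S′ u) x∈S′)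
  ... | inj₂ (refl , refl) = ∈ₛ-∷ʳ-true S′

≈-∷ʳ-last : ∀ {n U b b′} (S : Vec Bool n) → ¬ U n → (S ∷ʳ b) ≈[ U ] (S ∷ʳ b′)
agree (≈-∷ʳ-last {U = U} S ¬Un) u = mk⇔ (move u) (move u)
  where
  move : ∀ {b b′ x} → U x → x ∈ₛ (S ∷ʳ b) → x ∈ₛ (S ∷ʳ b′)
  move {b} {b′} u x∈S with ∈ₛ-∷ʳ⁻ S b x∈S
  ... | inj₁ x∈S′       = ∈ₛ-∷ʳ⁺ S b′ x∈S′
  ... | inj₂ (refl , _) = ⊥-elim (¬Un u)

⊆ₛ-transport : ∀ {n U l} {S S′ : Vec Bool n} → S ≈[ U ] S′ → All U l → l ⊆ₛ S → l ⊆ₛ S′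
⊆ₛ-transport S≈S′ Ul l⊆S = All.zipWith (λ (u , x∈S) → Equivalence.to (agree S≈S′ u) x∈S) (Ul , l⊆S)

-- Hyperedge families and their free sets

remove : ℕ → List ℕ → List ℕ
remove v = filter (λ x → ¬? (x ≟ v))

∈-remove⁻ : ∀ {v x} l → x ∈ remove v l → x ∈ l × x ≢ v
∈-remove⁻ {v} l = ∈-filter⁻ (λ x → ¬? (x ≟ v)) {xs = l}

∈-remove⁺ : ∀ {v x l} → x ∈ l → x ≢ v → x ∈ remove v l
∈-remove⁺ {v} = ∈-filter⁺ (λ x → ¬? (x ≟ v))

∉⇒All≢ : ∀ {v} {l : List ℕ} → v ∉ l → All (_≢ v) l
∉⇒All≢ v∉l = All.tabulate λ { x∈l refl → v∉l x∈l }

length-remove : ∀ v l → length (remove v l) ≤ length l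
length-remove v = length-filter (λ x → ¬? (x ≟ v))

length-remove-< : ∀ {v} {l : List ℕ} → v ∈ l → length (remove v l) < length l
length-remove-< {v} {l} v∈l = filter-notAll (λ x → ¬? (x ≟ v)) l (Any.map (λ v≡x x≢v → x≢v (sym v≡x)) v∈l)

remove-∉ : ∀ {v} {l : List ℕ} → v ∉ l → remove v l ≡ l
remove-∉ {v} v∉l = filter-all (λ x → ¬? (x ≟ v)) (∉⇒All≢ v∉l)

bounded : ∀ l → ∃ λ N → All (_< N) l
bounded []      = 0 , []
bounded (x ∷ l) = let N , l<N = bounded l in suc x + N , s≤s (m≤m+n x N) ∷ All.map (m≤n⇒m≤o+n (suc x)) l<N

Edges : Set₁
Edges = List ℕ → Set

Free : Edges → (n : ℕ) → Vec Bool n → Set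
Free E n S = ∀ l → E l → ¬ l ⊆ₛ S

Free-dependsOnly : ∀ {n U} {E : Edges} → (∀ l → E l → All U l) → DependsOnlyOn U (Free E n)
Free-dependsOnly edges⊆U S≈S′ free l e l⊆S′ = free l e (⊆ₛ-transport (≈-sym S≈S′) (edges⊆U l e) l⊆S′)

Free-∷ʳ : ∀ {n E} (S : Vec Bool n) b → Free E (suc n) (S ∷ʳ b) → Free E n S
Free-∷ʳ S b free l e l⊆S = free l e (All.map (∈ₛ-∷ʳ⁺ S b) l⊆S)

delete : ℕ → Edges → Edges
delete v E l = E l × v ∉ l

contract : ℕ → Edges → Edges
contract v E l = ∃ λ l′ → E l′ × l ≡ remove v l′

delete-Free⇒Free : ∀ {n v E} {S : Vec Bool n} → ¬ v ∈ₛ S → Free (delete v E) n S → Free E n S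
delete-Free⇒Free {v = v} v∉S free l e l⊆S with v ∈? l
... | yes v∈l = v∉S (All.lookup l⊆S v∈l)
... | no v∉l  = free l (e , v∉l) l⊆S

Free⇒delete-Free : ∀ {n v E} {S : Vec Bool n} → Free E n S → Free (delete v E) n S
Free⇒delete-Free free l (e , _) = free l e

contract-Free⇒Free : ∀ {n v E} {S : Vec Bool n} → Free (contract v E) n S → Free E n S
contract-Free⇒Free {v = v} free l e l⊆S =
  free (remove v l) (l , e , refl) (All.tabulate (All.lookup l⊆S ∘ proj₁ ∘ ∈-remove⁻ l))

Free⇒contract-Free : ∀ {n v E} {S : Vec Bool n} → v ∈ₛ S → Free E n S → Free (contract v E) n S
Free⇒contract-Free {v = v} {S = S} v∈S free l (l′ , e , refl) l⊆S = free l′ e (All.tabulate covered)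
  where
  covered : ∀ {x} → x ∈ l′ → x ∈ₛ S
  covered {x} x∈l′ with x ≟ v
  ... | yes refl = v∈S
  ... | no x≢v   = All.lookup l⊆S (∈-remove⁺ x∈l′ x≢v)

delete-Free-dependsOnly : ∀ {n v E} → DependsOnlyOn (_≢ v) (Free (delete v E) n)
delete-Free-dependsOnly = Free-dependsOnly λ l (_ , v∉l) → ∉⇒All≢ v∉l

contract-Free-dependsOnly : ∀ {n v E} → DependsOnlyOn (_≢ v) (Free (contract v E) n)
contract-Free-dependsOnly = Free-dependsOnly λ { l (l′ , _ , refl) → All.tabulate (proj₂ ∘ ∈-remove⁻ l′) }

Within : Hypergraph → ∀ {n} → Vec Bool n → Set
Within H S = ∀ x → x ∈ₛ S → V H x ≡ true

Within-∷ʳ⁻ : ∀ {H n} (S : Vec Bool n) b → Within H (S ∷ʳ b) → Within H S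
Within-∷ʳ⁻ S b within x x∈S = within x (∈ₛ-∷ʳ⁺ S b x∈S)

Within-∷ʳ⁺ : ∀ {H n} (S : Vec Bool n) b → (b ≡ true → V H n ≡ true) → Within H S → Within H (S ∷ʳ b)
Within-∷ʳ⁺ S b new within x x∈S with ∈ₛ-∷ʳ⁻ S b x∈S
... | inj₁ x∈S′        = within x x∈S′
... | inj₂ (refl , b≡true) = new b≡true

-- Densities of sub-doubling sequences

SubDoubling : (ℕ → ℕ) → Set
SubDoubling f = ∀ n → f (suc n) ≤ 2 * f n

subDoubling-+ : ∀ f → SubDoubling f → ∀ d n → f (d + n) ≤ 2 ^ d * f n
subDoubling-+ f sd zero    n = ≤-reflexive (sym (+-identityʳ (f n)))
subDoubling-+ f sd (suc d) n = begin
  f (suc d + n)      ≤⟨ sd (d + n) ⟩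
  2 * f (d + n)      ≤⟨ *-monoʳ-≤ 2 (subDoubling-+ f sd d n) ⟩
  2 * (2 ^ d * f n)  ≡⟨ *-assoc 2 (2 ^ d) (f n) ⟨
  2 ^ suc d * f n    ∎
  where open ≤-Reasoning

-- num / den ≤ f n / 2 ^ n for every n, and f N / 2 ^ N ≤ num / den + 1 / suc m for some N.
record Density (f : ℕ → ℕ) : Set where
  field
    num den-1 : ℕ

  den : ℕ
  den = suc den-1

  field
    below : ∀ n → num * 2 ^ n ≤ f n * den
    above : ∀ m → ∃ λ N → f N * (den * suc m) ≤ (num * suc m + den) * 2 ^ N

vanishing-density : ∀ {f} → (∀ m → ∃ λ N → f N * suc m ≤ 2 ^ N) → Density f
vanishing-density {f} small = record
  { num   = 0
  ; den-1 = 0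
  ; below = λ _ → z≤n
  ; above = λ m → let N , fN≤ = small m in
      N , subst₂ _≤_ (cong (f N *_) (sym (*-identityˡ (suc m)))) (sym (*-identityˡ (2 ^ N))) fN≤
  }

full-density : ∀ {f} → (∀ n → f n ≡ 2 ^ n) → Density f
full-density {f} full = record
  { num   = 1
  ; den-1 = 0
  ; below = λ n → ≤-reflexive (trans (*-identityˡ (2 ^ n)) (trans (sym (full n)) (sym (*-identityʳ (f n)))))
  ; above = λ m → 0 , (begin
      f 0 * (1 * suc m)  ≡⟨ cong (_* (1 * suc m)) (full 0) ⟩
      1 * (1 * suc m)    ≡⟨ *-identityˡ (1 * suc m) ⟩
      1 * suc m          ≤⟨ m≤m+n (1 * suc m) 1 ⟩
      1 * suc m + 1      ≡⟨ *-identityʳ (1 * suc m + 1) ⟨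
      (1 * suc m + 1) * 1 ∎)
  }
  where open ≤-Reasoning

above-mono : ∀ f → SubDoubling f → ∀ c X {N N′} → N ≤ N′ → f N * c ≤ X * 2 ^ N → f N′ * c ≤ X * 2 ^ N′
above-mono f sd c X {N} {N′} N≤N′ fN≤ = subst (λ K → f K * c ≤ X * 2 ^ K) (m∸n+n≡m N≤N′) (begin
  f (d + N) * c        ≤⟨ *-monoˡ-≤ c (subDoubling-+ f sd d N) ⟩
  2 ^ d * f N * c      ≡⟨ *-assoc (2 ^ d) (f N) c ⟩
  2 ^ d * (f N * c)    ≤⟨ *-monoʳ-≤ (2 ^ d) fN≤ ⟩
  2 ^ d * (X * 2 ^ N)  ≡⟨ x∙yz≈y∙xz (2 ^ d) X (2 ^ N) ⟩
  X * (2 ^ d * 2 ^ N)  ≡⟨ cong (X *_) (^-distribˡ-+-* 2 d N) ⟨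
  X * 2 ^ (d + N)      ∎)
  where
  open ≤-Reasoning
  d = N′ ∸ N

below-from-tail : ∀ f → SubDoubling f → ∀ a D v →
                  (∀ n → v < n → a * 2 ^ n ≤ f n * D) → ∀ n → a * 2 ^ n ≤ f n * D
below-from-tail f sd a D v tail n = *-cancelˡ-≤ (2 ^ suc v) {{m^n≢0 2 (suc v)}} (begin
  2 ^ suc v * (a * 2 ^ n)  ≡⟨ x∙yz≈y∙xz (2 ^ suc v) a (2 ^ n) ⟩
  a * (2 ^ suc v * 2 ^ n)  ≡⟨ cong (a *_) (^-distribˡ-+-* 2 (suc v) n) ⟨
  a * 2 ^ (suc v + n)      ≤⟨ tail (suc v + n) (s≤s (m≤m+n v n)) ⟩
  f (suc v + n) * D        ≤⟨ *-monoˡ-≤ D (subDoubling-+ f sd (suc v) n) ⟩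
  2 ^ suc v * f n * D      ≡⟨ *-assoc (2 ^ suc v) (f n) D ⟩
  2 ^ suc v * (f n * D)    ∎)
  where open ≤-Reasoning

-- If 2 f = f₀ + f₁ eventually, the density of f is the mean (a₀ / D₀ + a₁ / D₁) / 2 of the other two.
density-mean : ∀ {f f₀ f₁} v → SubDoubling f → SubDoubling f₀ → SubDoubling f₁ →
               (∀ n → v < n → f n + f n ≡ f₀ n + f₁ n) → Density f₀ → Density f₁ → Density f
density-mean {f} {f₀} {f₁} v sd sd₀ sd₁ split d₀ d₁ = record
  { num = a ; den-1 = ℕ.pred D ; below = below-from-tail f sd a D v below′ ; above = above }
  where
  open Density d₀ using () renaming (num to a₀; den to D₀; below to below₀; above to above₀)
  open Density d₁ using () renaming (num to a₁; den to D₁; below to below₁; above to above₁)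
  open ≤-Reasoning
  a = a₀ * D₁ + a₁ * D₀
  D = D₀ * D₁ + D₀ * D₁

  below′ : ∀ n → v < n → a * 2 ^ n ≤ f n * D
  below′ n v<n = begin
    a * 2 ^ n                            ≡⟨ distribute a₀ a₁ D₀ D₁ (2 ^ n) ⟩
    a₀ * 2 ^ n * D₁ + a₁ * 2 ^ n * D₀    ≤⟨ +-mono-≤ (*-monoˡ-≤ D₁ (below₀ n)) (*-monoˡ-≤ D₀ (below₁ n)) ⟩
    f₀ n * D₀ * D₁ + f₁ n * D₁ * D₀      ≡⟨ collect (f₀ n) (f₁ n) D₀ D₁ ⟩
    (f₀ n + f₁ n) * (D₀ * D₁)            ≡⟨ cong (_* (D₀ * D₁)) (split n v<n) ⟨
    (f n + f n) * (D₀ * D₁)              ≡⟨ double (f n) (D₀ * D₁) ⟩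
    f n * D                              ∎
    where
    distribute : ∀ a₀ a₁ D₀ D₁ P → (a₀ * D₁ + a₁ * D₀) * P ≡ a₀ * P * D₁ + a₁ * P * D₀
    distribute = solve-∀
    collect : ∀ x y D₀ D₁ → x * D₀ * D₁ + y * D₁ * D₀ ≡ (x + y) * (D₀ * D₁)
    collect = solve-∀
    double : ∀ x E → (x + x) * E ≡ x * (E + E)
    double = solve-∀

  above : ∀ m → ∃ λ N → f N * (D * suc m) ≤ (a * suc m + D) * 2 ^ N
  above m =
    let N₀ , f₀N₀≤ = above₀ m
        N₁ , f₁N₁≤ = above₁ m
        N = N₀ + N₁ + suc v
        N₀≤N = ≤-trans (m≤m+n N₀ N₁) (m≤m+n (N₀ + N₁) (suc v))
        N₁≤N = ≤-trans (m≤n+m N₁ N₀) (m≤m+n (N₀ + N₁) (suc v))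
        f₀N≤ = above-mono f₀ sd₀ (D₀ * suc m) (a₀ * suc m + D₀) N₀≤N f₀N₀≤
        f₁N≤ = above-mono f₁ sd₁ (D₁ * suc m) (a₁ * suc m + D₁) N₁≤N f₁N₁≤
    in N , (begin
      f N * (D * suc m)
        ≡⟨ double (f N) (D₀ * D₁) (suc m) ⟩
      (f N + f N) * (D₀ * D₁) * suc m
        ≡⟨ cong (λ x → x * (D₀ * D₁) * suc m) (split N (m≤n+m (suc v) (N₀ + N₁))) ⟩
      (f₀ N + f₁ N) * (D₀ * D₁) * suc m
        ≡⟨ distribute (f₀ N) (f₁ N) D₀ D₁ (suc m) ⟩
      f₀ N * (D₀ * suc m) * D₁ + f₁ N * (D₁ * suc m) * D₀
        ≤⟨ +-mono-≤ (*-monoˡ-≤ D₁ f₀N≤) (*-monoˡ-≤ D₀ f₁N≤) ⟩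
      (a₀ * suc m + D₀) * 2 ^ N * D₁ + (a₁ * suc m + D₁) * 2 ^ N * D₀
        ≡⟨ collect a₀ a₁ D₀ D₁ (suc m) (2 ^ N) ⟩
      (a * suc m + D) * 2 ^ N
        ∎)
    where
    double : ∀ x E M → x * ((E + E) * M) ≡ (x + x) * E * M
    double = solve-∀
    distribute : ∀ x y D₀ D₁ M → (x + y) * (D₀ * D₁) * M ≡ x * (D₀ * M) * D₁ + y * (D₁ * M) * D₀
    distribute = solve-∀
    collect : ∀ a₀ a₁ D₀ D₁ M P →
              (a₀ * M + D₀) * P * D₁ + (a₁ * M + D₁) * P * D₀
              ≡ ((a₀ * D₁ + a₁ * D₀) * M + (D₀ * D₁ + D₀ * D₁)) * P
    collect = solve-∀

bernoulli : ∀ J r → J ^ r * (J + r) ≤ J * suc J ^ r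
bernoulli J zero    = ≤-reflexive (trans (*-identityˡ (J + 0)) (trans (+-identityʳ J) (sym (*-identityʳ J))))
bernoulli J (suc r) = begin
  J * J ^ r * (J + suc r)        ≡⟨ xy∙z≈y∙xz J (J ^ r) (J + suc r) ⟩
  J ^ r * (J * (J + suc r))      ≤⟨ *-monoʳ-≤ (J ^ r) (m≤m+n (J * (J + suc r)) r) ⟩
  J ^ r * (J * (J + suc r) + r)  ≡⟨ cong (J ^ r *_) (expand J r) ⟩
  J ^ r * (suc J * (J + r))      ≡⟨ x∙yz≈y∙xz (J ^ r) (suc J) (J + r) ⟩
  suc J * (J ^ r * (J + r))      ≤⟨ *-monoʳ-≤ (suc J) (bernoulli J r) ⟩
  suc J * (J * suc J ^ r)        ≡⟨ x∙yz≈y∙xz (suc J) J (suc J ^ r) ⟩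
  J * (suc J * suc J ^ r)        ∎
  where
  open ≤-Reasoning
  expand : ∀ J r → J * (J + suc r) + r ≡ suc J * (J + r)
  expand = solve-∀

-- In cross-multiplied form: if c / V = G / P, a lower (upper) bound X / Y on G / P is one on c / V.
cross-≤-resp : ∀ c V G P .{{_ : NonZero P}} X Y → c * P ≡ G * V → X * P ≤ G * Y → X * V ≤ c * Y
cross-≤-resp c V G P X Y c/V≡G/P XP≤GY = *-cancelˡ-≤ P (begin
  P * (X * V)   ≡⟨ rearrange P X V ⟩
  X * P * V     ≤⟨ *-monoˡ-≤ V XP≤GY ⟩
  G * Y * V     ≡⟨ rearrange′ G Y V ⟩
  G * V * Y     ≡⟨ cong (_* Y) c/V≡G/P ⟨
  c * P * Y     ≡⟨ rearrange″ c P Y ⟩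
  P * (c * Y)   ∎)
  where
  open ≤-Reasoning
  rearrange : ∀ P X V → P * (X * V) ≡ X * P * V
  rearrange = solve-∀
  rearrange′ : ∀ G Y V → G * Y * V ≡ G * V * Y
  rearrange′ = solve-∀
  rearrange″ : ∀ c P Y → c * P * Y ≡ P * (c * Y)
  rearrange″ = solve-∀

cross-≥-resp : ∀ c V G P .{{_ : NonZero P}} X Y → c * P ≡ G * V → G * Y ≤ X * P → c * Y ≤ X * V
cross-≥-resp c V G P X Y c/V≡G/P GY≤XP = *-cancelˡ-≤ P (begin
  P * (c * Y)   ≡⟨ rearrange P c Y ⟩
  c * P * Y     ≡⟨ cong (_* Y) c/V≡G/P ⟩
  G * V * Y     ≡⟨ rearrange′ G V Y ⟩
  V * (G * Y)   ≤⟨ *-monoʳ-≤ V GY≤XP ⟩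
  V * (X * P)   ≡⟨ rearrange″ V X P ⟩
  P * (X * V)   ∎)
  where
  open ≤-Reasoning
  rearrange : ∀ P c Y → P * (c * Y) ≡ c * P * Y
  rearrange = solve-∀
  rearrange′ : ∀ G V Y → G * V * Y ≡ V * (G * Y)
  rearrange′ = solve-∀
  rearrange″ : ∀ V X P → V * (X * P) ≡ P * (X * V)
  rearrange″ = solve-∀

-- Rational arithmetic

toℚᵘ-/ : ∀ i d .{{_ : NonZero d}} → toℚᵘ (i ℚ./ d) ℚᵘ.≃ i ℚᵘ./ d
toℚᵘ-/ i (suc d) = ℚ.toℚᵘ-fromℚᵘ (ℚᵘ.mkℚᵘ i d)

/-cross-≤ : ∀ a b c d .{{_ : NonZero b}} .{{_ : NonZero d}} → a * d ≤ c * b → + a ℚ./ b ℚ.≤ + c ℚ./ d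
/-cross-≤ a b@(suc _) c d@(suc _) ad≤cb = ℚ.toℚᵘ-cancel-≤
  (ℚᵘ.≤-respˡ-≃ (ℚᵘ.≃-sym (toℚᵘ-/ (+ a) b)) (ℚᵘ.≤-respʳ-≃ (ℚᵘ.≃-sym (toℚᵘ-/ (+ c) d))
    (ℚᵘ.*≤* (subst₂ ℤ._≤_ (ℤ.pos-* a d) (ℤ.pos-* c b) (ℤ.+≤+ ad≤cb)))))

/-cross-< : ∀ a b c d .{{_ : NonZero b}} .{{_ : NonZero d}} → a * d < c * b → + a ℚ./ b ℚ.< + c ℚ./ d
/-cross-< a b@(suc _) c d@(suc _) ad<cb = ℚ.toℚᵘ-cancel-<
  (ℚᵘ.<-respˡ-≃ (ℚᵘ.≃-sym (toℚᵘ-/ (+ a) b)) (ℚᵘ.<-respʳ-≃ (ℚᵘ.≃-sym (toℚᵘ-/ (+ c) d))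
    (ℚᵘ.*<* (subst₂ ℤ._<_ (ℤ.pos-* a d) (ℤ.pos-* c b) (ℤ.+<+ ad<cb)))))

/+1/ : ∀ a b m → + a ℚ./ suc b ℚ.+ + 1 ℚ./ suc m ≡ + (a * suc m + suc b) ℚ./ (suc b * suc m)
/+1/ a b m = ℚ.toℚᵘ-injective (ℚᵘ.≃-trans (ℚ.toℚᵘ-homo-+ (+ a ℚ./ suc b) (+ 1 ℚ./ suc m))
  (ℚᵘ.≃-trans (ℚᵘ.+-cong (toℚᵘ-/ (+ a) (suc b)) (toℚᵘ-/ (+ 1) (suc m)))
  (ℚᵘ.≃-trans (ℚᵘ.≃-reflexive (cong (ℚᵘ._/ (suc b * suc m)) numerator))
              (ℚᵘ.≃-sym (toℚᵘ-/ (+ (a * suc m + suc b)) (suc b * suc m))))))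
  where
  numerator : + a ℤ.* + suc m ℤ.+ + 1 ℤ.* + suc b ≡ + (a * suc m + suc b)
  numerator = trans (cong₂ ℤ._+_ (sym (ℤ.pos-* a (suc m))) (ℤ.*-identityˡ (+ suc b))) (sym (ℤ.pos-+ (a * suc m) (suc b)))

∣p-q∣<ε : ∀ {p q r ε} → q ℚ.≤ p → p ℚ.≤ q ℚ.+ r → r ℚ.< ε → ℚ.∣ p ℚ.- q ∣ ℚ.< ε
∣p-q∣<ε {p} {q} {r} {ε} q≤p p≤q+r r<ε = begin-strict
  ℚ.∣ p ℚ.- q ∣   ≡⟨ ℚ.0≤p⇒∣p∣≡p 0≤p-q ⟩
  p ℚ.- q         ≤⟨ ℚ.+-monoˡ-≤ (ℚ.- q) p≤q+r ⟩
  q ℚ.+ r ℚ.- q   ≡⟨ xyx⁻¹≈y q r ⟩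
  r               <⟨ r<ε ⟩
  ε               ∎
  where
  open ℚ.≤-Reasoning
  0≤p-q : 0ℚ ℚ.≤ p ℚ.- q
  0≤p-q = subst (ℚ._≤ p ℚ.- q) (ℚ.+-inverseʳ q) (ℚ.+-monoˡ-≤ (ℚ.- q) q≤p)

archimedean : ∀ ε → 0ℚ ℚ.< ε → ∃ λ m → + 1 ℚ./ suc m ℚ.< ε
archimedean ε@(mkℚ (+ suc n) d _) _ = suc d , subst (_ ℚ.<_) (ℚ.↥p/↧p≡p ε)
  (/-cross-< 1 (suc (suc d)) (suc n) (suc d)
    (subst (_< suc n * suc (suc d)) (sym (*-identityˡ (suc d))) (<-≤-trans (n<1+n (suc d)) (m≤n*m (suc (suc d)) (suc n)))))
archimedean (mkℚ (+ zero) d _) (ℚ.*<* (ℤ.+<+ ()))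
archimedean (mkℚ -[1+ n ] d _) (ℚ.*<* ())

-- Classical counting

module Counting (em : ExcludedMiddle 0ℓ) where

  indicator : ∀ {A : Set} → Dec A → ℕ
  indicator (yes _) = 1
  indicator (no _)  = 0

  indicator-yes : ∀ {A : Set} → A → (a? : Dec A) → indicator a? ≡ 1
  indicator-yes a (yes _) = refl
  indicator-yes a (no ¬a) = ⊥-elim (¬a a)

  indicator-no : ∀ {A : Set} → ¬ A → (a? : Dec A) → indicator a? ≡ 0
  indicator-no ¬a (yes a) = ⊥-elim (¬a a)
  indicator-no ¬a (no _)  = refl

  indicator-mono : ∀ {A B : Set} → (A → B) → (a? : Dec A) (b? : Dec B) → indicator a? ≤ indicator b?
  indicator-mono f (yes a) b?     = ≤-reflexive (sym (indicator-yes (f a) b?))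
  indicator-mono f (no _)  _      = z≤n

  count : ∀ n → (Vec Bool n → Set) → ℕ
  count zero    P = indicator (em {P Vec.[]})
  count (suc n) P = count n (λ S → P (S ∷ʳ false)) + count n (λ S → P (S ∷ʳ true))

  count-mono : ∀ n {P Q : Vec Bool n → Set} → (∀ {S} → P S → Q S) → count n P ≤ count n Q
  count-mono zero    P⇒Q = indicator-mono P⇒Q em em
  count-mono (suc n) P⇒Q = +-mono-≤ (count-mono n P⇒Q) (count-mono n P⇒Q)

  count-cong : ∀ n {P Q : Vec Bool n → Set} → (∀ {S} → P S → Q S) → (∀ {S} → Q S → P S) → count n P ≡ count n Q
  count-cong n P⇒Q Q⇒P = ≤-antisym (count-mono n P⇒Q) (count-mono n Q⇒P)

  count-split : ∀ n (P Q : Vec Bool n → Set) → count n P ≡ count n (λ S → P S × Q S) + count n (λ S → P S × ¬ Q S)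
  count-split zero P Q with em {P Vec.[]} | em {Q Vec.[]}
  ... | yes p | yes q = sym (cong₂ _+_ (indicator-yes (p , q) em) (indicator-no (λ (_ , ¬q) → ¬q q) em))
  ... | yes p | no ¬q = sym (cong₂ _+_ (indicator-no (¬q ∘ proj₂) em) (indicator-yes (p , ¬q) em))
  ... | no ¬p | _     = sym (cong₂ _+_ (indicator-no (¬p ∘ proj₁) em) (indicator-no (¬p ∘ proj₁) em))
  count-split (suc n) P Q = trans (cong₂ _+_ (count-split n P₀ Q₀) (count-split n P₁ Q₁))
    (+-interchange (count n (λ S → P₀ S × Q₀ S)) (count n (λ S → P₀ S × ¬ Q₀ S))
                   (count n (λ S → P₁ S × Q₁ S)) (count n (λ S → P₁ S × ¬ Q₁ S)))
    where
    P₀ P₁ Q₀ Q₁ : Vec Bool n → Set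
    P₀ S = P (S ∷ʳ false)
    P₁ S = P (S ∷ʳ true)
    Q₀ S = Q (S ∷ʳ false)
    Q₁ S = Q (S ∷ʳ true)

  count-all : ∀ n {P : Vec Bool n → Set} → (∀ S → P S) → count n P ≡ 2 ^ n
  count-all zero    all = indicator-yes (all Vec.[]) em
  count-all (suc n) all = trans (cong₂ _+_ (count-all n (all ∘ (_∷ʳ false))) (count-all n (all ∘ (_∷ʳ true))))
                                (cong (_+_ (2 ^ n)) (sym (+-identityʳ (2 ^ n))))

  count-none : ∀ n {P : Vec Bool n → Set} → (∀ S → ¬ P S) → count n P ≡ 0
  count-none zero    none = indicator-no (none Vec.[]) em
  count-none (suc n) none = cong₂ _+_ (count-none n (none ∘ (_∷ʳ false))) (count-none n (none ∘ (_∷ʳ true)))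

  count≤2^n : ∀ n (P : Vec Bool n → Set) → count n P ≤ 2 ^ n
  count≤2^n n P = ≤-trans (count-mono n {Q = λ _ → ⊤} _) (≤-reflexive (count-all n _))

  satisfying₀ : ∀ {A : Set} → Dec A → List (Vec Bool 0)
  satisfying₀ (yes _) = Vec.[] ∷ []
  satisfying₀ (no _)  = []

  satisfying : ∀ n → (Vec Bool n → Set) → List (Vec Bool n)
  satisfying zero    P = satisfying₀ (em {P Vec.[]})
  satisfying (suc n) P = map (_∷ʳ false) (satisfying n (λ S → P (S ∷ʳ false)))
                      ++ map (_∷ʳ true) (satisfying n (λ S → P (S ∷ʳ true)))

  length-satisfying : ∀ n P → length (satisfying n P) ≡ count n P
  length-satisfying zero P with em {P Vec.[]}
  ... | yes _ = refl
  ... | no _  = refl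
  length-satisfying (suc n) P = begin
    length (map (_∷ʳ false) L₀ ++ map (_∷ʳ true) L₁)
      ≡⟨ length-++ (map (_∷ʳ false) L₀) ⟩
    length (map (_∷ʳ false) L₀) + length (map (_∷ʳ true) L₁)
      ≡⟨ cong₂ _+_ (length-map (_∷ʳ false) L₀) (length-map (_∷ʳ true) L₁) ⟩
    length L₀ + length L₁
      ≡⟨ cong₂ _+_ (length-satisfying n _) (length-satisfying n _) ⟩
    count (suc n) P ∎
    where
    open ≡-Reasoning
    L₀ = satisfying n (λ S → P (S ∷ʳ false))
    L₁ = satisfying n (λ S → P (S ∷ʳ true))

  ∈-satisfying⁻ : ∀ n {P S} → S ∈ satisfying n P → P S
  ∈-satisfying⁻ zero {P} {Vec.[]} S∈ with em {P Vec.[]}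
  ... | yes p = p
  ∈-satisfying⁻ zero {P} () | no _
  ∈-satisfying⁻ (suc n) {P} S∈ with ∈-++⁻ (map (_∷ʳ false) (satisfying n (λ S → P (S ∷ʳ false)))) S∈
  ... | inj₁ S∈₀ with ∈-map⁻ _ S∈₀
  ...   | T , T∈ , refl = ∈-satisfying⁻ n T∈
  ∈-satisfying⁻ (suc n) {P} S∈ | inj₂ S∈₁ with ∈-map⁻ _ S∈₁
  ...   | T , T∈ , refl = ∈-satisfying⁻ n T∈

  ∈-satisfying⁺ : ∀ n {P S} → P S → S ∈ satisfying n P
  ∈-satisfying⁺ zero {P} {Vec.[]} p with em {P Vec.[]}
  ... | yes _ = here refl
  ... | no ¬p = ⊥-elim (¬p p)
  ∈-satisfying⁺ (suc n) {P} {S} p with initLast S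
  ... | T , false , refl = ∈-++⁺ˡ (∈-map⁺ (_∷ʳ false) (∈-satisfying⁺ n p))
  ... | T , true  , refl = ∈-++⁺ʳ (map (_∷ʳ false) (satisfying n _)) (∈-map⁺ (_∷ʳ true) (∈-satisfying⁺ n p))

  satisfying-unique : ∀ n P → Unique (satisfying n P)
  satisfying-unique zero P with em {P Vec.[]}
  ... | yes _ = [] ∷ []
  ... | no _  = []
  satisfying-unique (suc n) P = Unique.++⁺ (Unique.map⁺ (∷ʳ-injectiveˡ _ _) (satisfying-unique n _))
                                           (Unique.map⁺ (∷ʳ-injectiveˡ _ _) (satisfying-unique n _))
                                           last-differs
    where
    last-differs : ∀ {S} → ¬ (S ∈ map (_∷ʳ false) (satisfying n _) × S ∈ map (_∷ʳ true) (satisfying n _))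
    last-differs (S∈₀ , S∈₁) with ∈-map⁻ _ S∈₀ | ∈-map⁻ _ S∈₁
    ... | T , _ , refl | T′ , _ , eq with ∷ʳ-injectiveʳ T T′ eq
    ... | ()

  count-enumeration : ∀ n {P} {L : List (Vec Bool n)} → Unique L → (∀ S → S ∈ L ⇔ P S) → length L ≡ count n P
  count-enumeration n {P} {L} unique L⇔P =
    trans (↭-length (∼bag⇒↭ (unique∧set⇒bag unique (satisfying-unique n P) same))) (length-satisfying n P)
    where
    same : ∀ {S} → S ∈ L ⇔ S ∈ satisfying n P
    same {S} = mk⇔ (∈-satisfying⁺ n ∘ Equivalence.to (L⇔P S)) (Equivalence.from (L⇔P S) ∘ ∈-satisfying⁻ n)

  count-∈≡count-∉ : ∀ {n v} {P : Vec Bool n → Set} → v < n → DependsOnlyOn (_≢ v) P →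
                    count n (λ S → P S × v ∈ₛ S) ≡ count n (λ S → P S × ¬ v ∈ₛ S)
  count-∈≡count-∉ {suc n} {v} {P} v<1+n P-local with m<1+n⇒m<n∨m≡n v<1+n
  ... | inj₁ v<n = cong₂ _+_ (restrict false) (restrict true)
    where
    restrict : ∀ b → count n (λ S → P (S ∷ʳ b) × v ∈ₛ (S ∷ʳ b))
                   ≡ count n (λ S → P (S ∷ʳ b) × ¬ v ∈ₛ (S ∷ʳ b))
    restrict b = begin
      count n (λ S → P (S ∷ʳ b) × v ∈ₛ (S ∷ʳ b))
        ≡⟨ count-cong n (λ {S} → map₂ (∈ₛ-∷ʳ⁻-< S b v<n)) (λ {S} → map₂ (∈ₛ-∷ʳ⁺ S b)) ⟩
      count n (λ S → P (S ∷ʳ b) × v ∈ₛ S)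
        ≡⟨ count-∈≡count-∉ v<n (λ S≈S′ → P-local (≈-∷ʳ S≈S′)) ⟩
      count n (λ S → P (S ∷ʳ b) × ¬ v ∈ₛ S)
        ≡⟨ count-cong n (λ {S} → map₂ (_∘ ∈ₛ-∷ʳ⁻-< S b v<n)) (λ {S} → map₂ (_∘ ∈ₛ-∷ʳ⁺ S b)) ⟩
      count n (λ S → P (S ∷ʳ b) × ¬ v ∈ₛ (S ∷ʳ b)) ∎
      where open ≡-Reasoning
  ... | inj₂ refl = begin
    count n (λ S → P (S ∷ʳ false) × n ∈ₛ (S ∷ʳ false))
      + count n (λ S → P (S ∷ʳ true) × n ∈ₛ (S ∷ʳ true))
      ≡⟨ cong₂ _+_ (count-none n (λ S → ∉ₛ-∷ʳ-false S ∘ proj₂))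
                   (count-cong n (toggle ∘ proj₁) (λ {S} p → toggle p , ∈ₛ-∷ʳ-true S)) ⟩
    0 + count n (λ S → P (S ∷ʳ false))
      ≡⟨ +-comm 0 _ ⟩
    count n (λ S → P (S ∷ʳ false)) + 0
      ≡⟨ cong₂ _+_ (count-cong n proj₁ (λ {S} p → p , ∉ₛ-∷ʳ-false S))
                   (count-none n (λ S → (_$ ∈ₛ-∷ʳ-true S) ∘ proj₂)) ⟨
    count n (λ S → P (S ∷ʳ false) × ¬ n ∈ₛ (S ∷ʳ false))
      + count n (λ S → P (S ∷ʳ true) × ¬ n ∈ₛ (S ∷ʳ true)) ∎
    where
    open ≡-Reasoning
    toggle : ∀ {S b b′} → P (S ∷ʳ b) → P (S ∷ʳ b′)
    toggle {S} = P-local (≈-∷ʳ-last S (_$ refl))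

  nFree : Edges → ℕ → ℕ
  nFree E n = count n (Free E n)

  nFree-subDoubling : ∀ E → SubDoubling (nFree E)
  nFree-subDoubling E n =
    ≤-trans (+-mono-≤ (count-mono n (λ {S} → Free-∷ʳ S false)) (count-mono n (λ {S} → Free-∷ʳ S true)))
            (≤-reflexive (cong (_+_ (nFree E n)) (sym (+-identityʳ (nFree E n)))))

  nFree-delete-contract : ∀ E {n v} → v < n → nFree E n + nFree E n ≡ nFree (delete v E) n + nFree (contract v E) n
  nFree-delete-contract E {n} {v} v<n = begin
    nFree E n + nFree E n  ≡⟨ cong₂ _+_ split split ⟩
    (A + B) + (A + B)      ≡⟨ rearrange A B ⟩
    (B + B) + (A + A)      ≡⟨ cong₂ _+_ deleted contracted ⟨
    nFree (delete v E) n + nFree (contract v E) n ∎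
    where
    open ≡-Reasoning
    A = count n (λ S → Free (contract v E) n S × v ∈ₛ S)
    B = count n (λ S → Free (delete v E) n S × ¬ v ∈ₛ S)
    split : nFree E n ≡ A + B
    split = trans (count-split n (Free E n) (v ∈ₛ_)) (cong₂ _+_
      (count-cong n (λ {S} (free , v∈S) → Free⇒contract-Free {S = S} v∈S free , v∈S)
                    (λ {S} → map₁ (contract-Free⇒Free {S = S})))
      (count-cong n (λ {S} → map₁ (Free⇒delete-Free {S = S}))
                    (λ {S} (free , v∉S) → delete-Free⇒Free {S = S} v∉S free , v∉S)))
    deleted : nFree (delete v E) n ≡ B + B
    deleted = trans (count-split n _ (v ∈ₛ_)) (cong (_+ B) (count-∈≡count-∉ v<n delete-Free-dependsOnly))
    contracted : nFree (contract v E) n ≡ A + A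
    contracted = trans (count-split n _ (v ∈ₛ_)) (cong (_+_ A) (sym (count-∈≡count-∉ v<n contract-Free-dependsOnly)))
    rearrange : ∀ a b → (a + b) + (a + b) ≡ (b + b) + (a + a)
    rearrange = solve-∀

  Rank : ℕ → Edges → Set
  Rank k E = ∀ l → E l → length l ≤ k

  rank-0-density : ∀ E → Rank 0 E → Density (nFree E)
  rank-0-density E rank with em {E []}
  ... | yes ∅∈E = vanishing-density λ m →
      0 , subst (λ c → c * suc m ≤ 1) (sym (count-none 0 {Free E 0} λ _ free → free [] ∅∈E [])) z≤n
  ... | no ∅∉E  = full-density λ n → count-all n λ S l e _ → ∅∉E (subst E (empty l (rank l e)) e)
    where
    empty : ∀ l → length l ≤ 0 → l ≡ []
    empty [] _ = refl

  count≤2^length*count-containing : ∀ n l {P : Vec Bool n → Set} → (∀ {v} → v ∈ l → DependsOnlyOn (_≢ v) P) →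
    All (_< n) l → count n P ≤ 2 ^ length l * count n (λ S → P S × l ⊆ₛ S)
  count≤2^length*count-containing n [] P-local [] =
    ≤-reflexive (trans (count-cong n (λ p → p , []) proj₁) (sym (+-identityʳ _)))
  count≤2^length*count-containing n (v ∷ l) {P} P-local (v<n ∷ l<n) = begin
    count n P                                          ≤⟨ count≤2^length*count-containing n l (P-local ∘ there) l<n ⟩
    2 ^ length l * count n Q                           ≤⟨ *-monoʳ-≤ (2 ^ length l) Q≤2*Qᵥ ⟩
    2 ^ length l * (2 * count n Qᵥ)                    ≡⟨ x∙yz≈y∙xz (2 ^ length l) 2 (count n Qᵥ) ⟩
    2 * (2 ^ length l * count n Qᵥ)                    ≡⟨ *-assoc 2 (2 ^ length l) (count n Qᵥ) ⟨
    2 ^ length (v ∷ l) * count n Qᵥ                    ≡⟨ cong (2 ^ length (v ∷ l) *_) Qᵥ≡ ⟩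
    2 ^ length (v ∷ l) * count n (λ S → P S × (v ∷ l) ⊆ₛ S) ∎
    where
    open ≤-Reasoning
    Q Qᵥ : Vec Bool n → Set
    Q S = P S × l ⊆ₛ S
    Qᵥ S = Q S × v ∈ₛ S
    Qᵥ≡ : count n Qᵥ ≡ count n (λ S → P S × (v ∷ l) ⊆ₛ S)
    Qᵥ≡ = count-cong n (λ ((p , l⊆S) , v∈S) → p , v∈S ∷ l⊆S) (λ { (p , v∈S ∷ l⊆S) → (p , l⊆S) , v∈S })
    Q≤2*Qᵥ : count n Q ≤ 2 * count n Qᵥ
    Q≤2*Qᵥ with v ∈? l
    ... | yes v∈l = begin
      count n Q                      ≡⟨ count-cong n (λ q → q , All.lookup (proj₂ q) v∈l) proj₁ ⟩
      count n Qᵥ                     ≤⟨ m≤m+n (count n Qᵥ) (count n Qᵥ + 0) ⟩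
      2 * count n Qᵥ                 ∎
    ... | no v∉l = ≤-reflexive (begin-equality
      count n Q                                    ≡⟨ count-split n Q (v ∈ₛ_) ⟩
      count n Qᵥ + count n (λ S → Q S × ¬ v ∈ₛ S)  ≡⟨ cong (_+_ (count n Qᵥ)) (count-∈≡count-∉ v<n Q-local) ⟨
      count n Qᵥ + count n Qᵥ                      ≡⟨ cong (_+_ (count n Qᵥ)) (+-identityʳ (count n Qᵥ)) ⟨
      2 * count n Qᵥ                               ∎)
      where
      Q-local : DependsOnlyOn (_≢ v) Q
      Q-local S≈S′ (p , l⊆S) = P-local (here refl) S≈S′ p , ⊆ₛ-transport S≈S′ (∉⇒All≢ v∉l) l⊆S

  count-Free-∷ : ∀ n J e rs → 2 ^ length e ≤ suc J → All (Disjoint e) rs → All (_< n) e →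
    count n (Free (_∈ e ∷ rs) n) * suc J ≤ count n (Free (_∈ rs) n) * J
  count-Free-∷ n J e rs 2^e≤1+J disjoint e<n = begin
    count n (Free (_∈ e ∷ rs) n) * suc J  ≡⟨ cong (_* suc J) free-∷ ⟩
    C * suc J                             ≡⟨ *-suc C J ⟩
    C + C * J                             ≤⟨ +-monoˡ-≤ (C * J) C≤B*J ⟩
    B * J + C * J                         ≡⟨ *-distribʳ-+ J B C ⟨
    (B + C) * J                           ≡⟨ cong (_* J) split ⟨
    count n (Free (_∈ rs) n) * J          ∎
    where
    open ≤-Reasoning
    B = count n (λ S → Free (_∈ rs) n S × e ⊆ₛ S)
    C = count n (λ S → Free (_∈ rs) n S × ¬ e ⊆ₛ S)
    split : count n (Free (_∈ rs) n) ≡ B + C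
    split = count-split n (Free (_∈ rs) n) (e ⊆ₛ_)
    free-∷ : count n (Free (_∈ e ∷ rs) n) ≡ C
    free-∷ = count-cong n (λ free → (λ l l∈rs → free l (there l∈rs)) , free e (here refl))
                          (λ { (free , ¬e⊆S) l (here refl) → ¬e⊆S ; (free , _) l (there l∈rs) → free l l∈rs })
    rs-local : ∀ {v} → v ∈ e → DependsOnlyOn (_≢ v) (Free (_∈ rs) n)
    rs-local v∈e = Free-dependsOnly λ r r∈rs → ∉⇒All≢ λ v∈r → All.lookup disjoint r∈rs (v∈e , v∈r)
    C≤B*J : C ≤ B * J
    C≤B*J = +-cancelˡ-≤ B C (B * J) (begin
      B + C            ≡⟨ split ⟨
      count n (Free (_∈ rs) n) ≤⟨ count≤2^length*count-containing n e rs-local e<n ⟩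
      2 ^ length e * B ≤⟨ *-monoˡ-≤ B 2^e≤1+J ⟩
      suc J * B        ≡⟨ cong (_+_ B) (*-comm J B) ⟩
      B + B * J        ∎)

  count-Free-disjoint : ∀ n J rs → AllPairs Disjoint rs → All (λ e → 2 ^ length e ≤ suc J) rs → All (All (_< n)) rs →
    count n (Free (_∈ rs) n) * suc J ^ length rs ≤ J ^ length rs * 2 ^ n
  count-Free-disjoint n J [] [] [] [] =
    ≤-reflexive (trans (*-identityʳ _) (trans (count-all n λ _ _ ()) (sym (*-identityˡ _))))
  count-Free-disjoint n J (e ∷ rs) (disjoint ∷ pairwise) (2^e≤1+J ∷ small) (e<n ∷ rs<n) = begin
    count n (Free (_∈ e ∷ rs) n) * (suc J * suc J ^ length rs)  ≡⟨ *-assoc (count n (Free (_∈ e ∷ rs) n)) (suc J) _ ⟨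
    count n (Free (_∈ e ∷ rs) n) * suc J * suc J ^ length rs
      ≤⟨ *-monoˡ-≤ _ (count-Free-∷ n J e rs 2^e≤1+J disjoint e<n) ⟩
    count n (Free (_∈ rs) n) * J * suc J ^ length rs            ≡⟨ xy∙z≈y∙xz (count n (Free (_∈ rs) n)) J _ ⟩
    J * (count n (Free (_∈ rs) n) * suc J ^ length rs)          ≤⟨ *-monoʳ-≤ J (count-Free-disjoint n J rs pairwise small rs<n) ⟩
    J * (J ^ length rs * 2 ^ n)                                 ≡⟨ *-assoc J (J ^ length rs) (2 ^ n) ⟨
    J * J ^ length rs * 2 ^ n                                   ∎
    where open ≤-Reasoning

  Transversal : Edges → List ℕ → Set
  Transversal E T = ∀ l → E l → Any (_∈ T) l

  missed-edge : ∀ {E T} → ¬ Transversal E T → ∃ λ l → E l × ¬ Any (_∈ T) l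
  missed-edge {E} {T} ¬transversal with em {∃ λ l → E l × ¬ Any (_∈ T) l}
  ... | yes missed  = missed
  ... | no ¬missed = ⊥-elim (¬transversal λ l e →
          decidable-stable (Any.any? (_∈? T) l) λ ¬hit → ¬missed (l , e , ¬hit))

  disjoint-edges : ∀ {E} → (∀ T → ¬ Transversal E T) → ∀ r →
                   ∃ λ rs → length rs ≡ r × AllPairs Disjoint rs × All E rs
  disjoint-edges no-transversal zero    = [] , refl , [] , []
  disjoint-edges no-transversal (suc r) with disjoint-edges no-transversal r
  ... | rs , refl , pairwise , edges with missed-edge (no-transversal (concat rs))
  ...   | l , e , misses = l ∷ rs , refl , All.tabulate disjoint ∷ pairwise , e ∷ edges
    where
    disjoint : ∀ {r} → r ∈ rs → Disjoint l r
    disjoint r∈rs (v∈l , v∈r) = misses (lose v∈l (∈-concat⁺′ v∈r r∈rs))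

  -- Bernoulli's inequality makes (J / (1 + J)) ^ r, the bound from r disjoint edges, at most J / (J + r).
  no-transversal⇒vanishing : ∀ k E → Rank k E → (∀ T → ¬ Transversal E T) →
                             ∀ m → ∃ λ N → nFree E N * suc m ≤ 2 ^ N
  no-transversal⇒vanishing k E rank no-transversal m =
    let rs , length-rs , pairwise , edges = disjoint-edges no-transversal (J * m)
        N , rs<N = bounded (concat rs)
        r = length rs
        G = nFree E N
        X = count N (Free (_∈ rs) N)
        G≤X : G ≤ X
        G≤X = count-mono N λ free l l∈rs → free l (All.lookup edges l∈rs)
        small : All (λ e → 2 ^ length e ≤ suc J) rs
        small = All.map (λ e → m≤n⇒m≤1+n (^-monoʳ-≤ 2 (rank _ e))) edges
        G*[J+r]≤J*2^N : G * (J + r) ≤ J * 2 ^ N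
        G*[J+r]≤J*2^N = *-cancelˡ-≤ (J ^ r) {{m^n≢0 J r}} (begin
          J ^ r * (G * (J + r))      ≡⟨ x∙yz≈y∙xz (J ^ r) G (J + r) ⟩
          G * (J ^ r * (J + r))      ≤⟨ *-monoʳ-≤ G (bernoulli J r) ⟩
          G * (J * suc J ^ r)        ≡⟨ x∙yz≈y∙xz G J (suc J ^ r) ⟩
          J * (G * suc J ^ r)        ≤⟨ *-monoʳ-≤ J (*-monoˡ-≤ (suc J ^ r) G≤X) ⟩
          J * (X * suc J ^ r)        ≤⟨ *-monoʳ-≤ J (count-Free-disjoint N J rs pairwise small (concat⁻ rs<N)) ⟩
          J * (J ^ r * 2 ^ N)        ≡⟨ x∙yz≈y∙xz J (J ^ r) (2 ^ N) ⟩
          J ^ r * (J * 2 ^ N)        ∎)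
    in N , *-cancelˡ-≤ J (begin
      J * (G * suc m)   ≡⟨ x∙yz≈y∙xz J G (suc m) ⟩
      G * (J * suc m)   ≡⟨ cong (G *_) (trans (*-suc J m) (cong (_+_ J) (sym length-rs))) ⟩
      G * (J + r)       ≤⟨ G*[J+r]≤J*2^N ⟩
      J * 2 ^ N         ∎)
    where
    open ≤-Reasoning
    J = 2 ^ k
    instance
      J≢0 : NonZero J
      J≢0 = m^n≢0 2 k

  transversal-density : ∀ k → (∀ E → Rank k E → Density (nFree E)) →
    ∀ T E → Rank (suc k) E → (∀ l → E l → suc k ≤ length l → Any (_∈ T) l) → Density (nFree E)
  transversal-density k rank-k [] E rank hit = rank-k E rank′
    where
    rank′ : Rank k E
    rank′ l e with length l ≤? k
    ... | yes l≤k = l≤k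
    ... | no  l≰k with find (hit l e (≰⇒> l≰k))
    ...   | _ , _ , ()
  transversal-density k rank-k (v ∷ T) E rank hit =
    density-mean v (nFree-subDoubling E) (nFree-subDoubling (delete v E)) (nFree-subDoubling (contract v E))
      (λ n → nFree-delete-contract E)
      (transversal-density k rank-k T (delete v E) (λ l (e , _) → rank l e) hit-deleted)
      (transversal-density k rank-k T (contract v E) rank-contracted hit-contracted)
    where
    avoid-v : ∀ {l} → v ∉ l → Any (_∈ v ∷ T) l → Any (_∈ T) l
    avoid-v v∉l (here (here refl))  = ⊥-elim (v∉l (here refl))
    avoid-v v∉l (here (there x∈T)) = here x∈T
    avoid-v v∉l (there hits)        = there (avoid-v (v∉l ∘ there) hits)
    hit-deleted : ∀ l → delete v E l → suc k ≤ length l → Any (_∈ T) l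
    hit-deleted l (e , v∉l) long = avoid-v v∉l (hit l e long)
    rank-contracted : Rank (suc k) (contract v E)
    rank-contracted l (l′ , e , refl) = ≤-trans (length-remove v l′) (rank l′ e)
    -- a long edge loses nothing when v is removed, so it is an edge of E avoiding v
    hit-contracted : ∀ l → contract v E l → suc k ≤ length l → Any (_∈ T) l
    hit-contracted l (l′ , e , refl) long = subst (Any (_∈ T)) (sym (remove-∉ v∉l′))
                                                  (avoid-v v∉l′ (hit l′ e (≤-trans long (length-remove v l′))))
      where
      v∉l′ : v ∉ l′
      v∉l′ v∈l′ = <-irrefl refl (≤-trans (length-remove-< v∈l′) (≤-trans (rank l′ e) long))

  rank-density : ∀ k E → Rank k E → Density (nFree E)
  rank-density zero    E rank = rank-0-density E rank
  rank-density (suc k) E rank with em {∃ λ T → Transversal E T}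
  ... | yes (T , transversal) = transversal-density k (rank-density k) T E rank λ l e _ → transversal l e
  ... | no  ¬transversal      = vanishing-density
                                  (no-transversal⇒vanishing (suc k) E rank λ T transversal → ¬transversal (T , transversal))

  count-Within-∷ʳ : ∀ H {n} b {P : Vec Bool (suc n) → Set} → (b ≡ true → V H n ≡ true) →
                    count n (λ S → Within H S × P (S ∷ʳ b)) ≡ count n (λ S → Within H (S ∷ʳ b) × P (S ∷ʳ b))
  count-Within-∷ʳ H {n} b new = count-cong n (λ {S} (within , p) → Within-∷ʳ⁺ {H} S b new within , p)
                                             (λ {S} → map₁ (Within-∷ʳ⁻ {H} S b))

  -- Each vertex of [0, n) outside V doubles the count.
  count-Within : ∀ H n {P : Vec Bool n → Set} → DependsOnlyOn (λ x → V H x ≡ true) P →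
                 count n P * 2 ^ vcount H n ≡ count n (λ S → Within H S × P S) * 2 ^ n
  count-Within H zero    {P} P-local =
    cong (_* 1) (count-cong 0 {Q = λ S → Within H S × P S} (λ {S} p → (λ x x∈S → ⊥-elim (∉ₛ-[] S x∈S)) , p) proj₂)
  count-Within H (suc n) {P} P-local with V H n in Vn
  ... | true = begin
    (c P₀ + c P₁) * (2 * 2 ^ vcount H n)
      ≡⟨ distrib (c P₀) (c P₁) (2 ^ vcount H n) ⟩
    2 * (c P₀ * 2 ^ vcount H n) + 2 * (c P₁ * 2 ^ vcount H n)
      ≡⟨ cong₂ (λ x y → 2 * x + 2 * y) (count-Within H n (P-local ∘ ≈-∷ʳ)) (count-Within H n (P-local ∘ ≈-∷ʳ)) ⟩
    2 * (w P₀ * 2 ^ n) + 2 * (w P₁ * 2 ^ n)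
      ≡⟨ distrib (w P₀) (w P₁) (2 ^ n) ⟨
    (w P₀ + w P₁) * (2 * 2 ^ n)
      ≡⟨ cong (_* (2 * 2 ^ n))
              (cong₂ _+_ (count-Within-∷ʳ H {n} false {P} λ ()) (count-Within-∷ʳ H {n} true {P} λ _ → Vn)) ⟩
    count (suc n) (λ S → Within H S × P S) * 2 ^ suc n ∎
    where
    open ≡-Reasoning
    c w : (Vec Bool n → Set) → ℕ
    c = count n
    w Q = count n (λ S → Within H S × Q S)
    P₀ P₁ : Vec Bool n → Set
    P₀ S = P (S ∷ʳ false)
    P₁ S = P (S ∷ʳ true)
    distrib : ∀ x y A → (x + y) * (2 * A) ≡ 2 * (x * A) + 2 * (y * A)
    distrib = solve-∀
  ... | false = begin
    (c P₀ + c P₁) * 2 ^ vcount H n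
      ≡⟨ cong (λ x → (c P₀ + x) * 2 ^ vcount H n) (count-cong n toggle toggle) ⟩
    (c P₀ + c P₀) * 2 ^ vcount H n
      ≡⟨ double (c P₀) (2 ^ vcount H n) ⟩
    2 * (c P₀ * 2 ^ vcount H n)
      ≡⟨ cong (2 *_) (count-Within H n (P-local ∘ ≈-∷ʳ)) ⟩
    2 * (w P₀ * 2 ^ n)
      ≡⟨ x∙yz≈y∙xz 2 (w P₀) (2 ^ n) ⟩
    w P₀ * (2 * 2 ^ n)
      ≡⟨ cong (_* (2 * 2 ^ n)) (trans (count-Within-∷ʳ H {n} false {P} λ ()) (sym (+-identityʳ _))) ⟩
    (count n (λ S → Within H (S ∷ʳ false) × P₀ S) + 0) * (2 * 2 ^ n)
      ≡⟨ cong (λ x → (count n (λ S → Within H (S ∷ʳ false) × P₀ S) + x) * (2 * 2 ^ n)) (sym none) ⟩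
    count (suc n) (λ S → Within H S × P S) * 2 ^ suc n ∎
    where
    open ≡-Reasoning
    c w : (Vec Bool n → Set) → ℕ
    c = count n
    w Q = count n (λ S → Within H S × Q S)
    P₀ P₁ : Vec Bool n → Set
    P₀ S = P (S ∷ʳ false)
    P₁ S = P (S ∷ʳ true)
    n∉V : ¬ V H n ≡ true
    n∉V n∈V with trans (sym n∈V) Vn
    ... | ()
    toggle : ∀ {S b b′} → P (S ∷ʳ b) → P (S ∷ʳ b′)
    toggle {S} = P-local (≈-∷ʳ-last S n∉V)
    none : count n (λ S → Within H (S ∷ʳ true) × P₁ S) ≡ 0
    none = count-none n λ S (within , _) → n∉V (within n (∈ₛ-∷ʳ-true S))
    double : ∀ x A → (x + x) * A ≡ 2 * (x * A)
    double = solve-∀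

  IndepCount⇒c*2^n≡nFree*2^v : ∀ {H n c} → IndepCount H n c → c * 2 ^ n ≡ nFree (E H) n * 2 ^ vcount H n
  IndepCount⇒c*2^n≡nFree*2^v {H} {n} (L , unique , L⇔indep , refl) =
    trans (cong (_* 2 ^ n) (count-enumeration n unique L⇔indep))
          (sym (count-Within H n (Free-dependsOnly (E⊆V H))))

  density⇒HasIdDensity : ∀ H (d : Density (nFree (E H))) → HasIdDensity H (+ Density.num d ℚ./ Density.den d)
  density⇒HasIdDensity H d ε 0<ε =
    let m , 1/m<ε = archimedean ε 0<ε
        N , fN≤   = above m
    in N , λ n N≤n c count → ∣p-q∣<ε (lower n c count) (upper m n N≤n fN≤ c count) 1/m<ε
    where
    open Density d
    f = nFree (E H)

    lower : ∀ n c → IndepCount H n c → + num ℚ./ den ℚ.≤ idFin H n c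
    lower n c count = /-cross-≤ num den c (2 ^ vcount H n)
      (cross-≤-resp c (2 ^ vcount H n) (f n) (2 ^ n) num den (IndepCount⇒c*2^n≡nFree*2^v {H} count) (below n))
      where instance _ = m^n≢0 2 n
                     _ = m^n≢0 2 (vcount H n)

    upper : ∀ m n {N} → N ≤ n → f N * (den * suc m) ≤ (num * suc m + den) * 2 ^ N →
            ∀ c → IndepCount H n c → idFin H n c ℚ.≤ + num ℚ./ den ℚ.+ + 1 ℚ./ suc m
    upper m n N≤n fN≤ c count = subst (idFin H n c ℚ.≤_) (sym (/+1/ num den-1 m))
      (/-cross-≤ c (2 ^ vcount H n) (num * suc m + den) (den * suc m)
        (cross-≥-resp c (2 ^ vcount H n) (f n) (2 ^ n) (num * suc m + den) (den * suc m)
          (IndepCount⇒c*2^n≡nFree*2^v {H} count)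
          (above-mono f (nFree-subDoubling (E H)) (den * suc m) (num * suc m + den) N≤n fN≤)))
      where instance _ = m^n≢0 2 n
                     _ = m^n≢0 2 (vcount H n)

theorem4 : ExcludedMiddle 0ℓ →
    (k : ℕ) → 1 ≤ k → (H : Hypergraph) → RankAtMost k H →
      ∃ λ (q : ℚ) → (0ℚ Data.Rational.≤ q × q Data.Rational.≤ 1ℚ) × HasIdDensity H q
-- The argument needs no lower bound on the rank.
theorem4 em k _ H rank = + num ℚ./ den , (0≤q , q≤1) , density⇒HasIdDensity H d
  where
  open Counting em
  d : Density (nFree (E H))
  d = rank-density k (E H) rank
  open Density d
  0≤q : 0ℚ ℚ.≤ + num ℚ./ den
  0≤q = /-cross-≤ 0 1 num den z≤n
  q≤1 : + num ℚ./ den ℚ.≤ 1ℚ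
  q≤1 = /-cross-≤ num den 1 1 (≤-trans (below 0) (*-monoˡ-≤ den (count≤2^n 0 (Free (E H) 0))))
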